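{- Let $G$ be a connected graph with vertex set $\{1,\dots,n\}$, $n\ge 2$, let $\Phi=(F_1,\dots,F_n)$ be an $n$-tuple of pairwise disjoint graphs with $\delta(F_i)=0$ and $|V(F_i)|\ge 2$ for all $i$, and let $G[\Phi]$ be the generalized lexicographic product. Then $G[\Phi]$ is well $\gamma_t$-dominated if and only if $G$ is well $\gamma_t$-dominated.
   Context: All graphs are finite, simple and undirected; $\delta(H)$ is the minimum degree. The generalized lexicographic product $G[\Phi]$ is the graph with vertex set $\bigcup_{i=1}^n V(F_i)$ in which each $F_i$ is an induced subgraph, and for $x\in V(F_i)$, $y\in V(F_j)$ with $i\neq j$, $xy$ is an edge iff $ij\in E(G)$. A total dominating set of $H$ is a set $S$ such that every vertex of $H$ has a neighbor in $S$; it is minimal if no proper subset is total dominating. $\gamma_t(H)$ is the minimum and $\Gamma_t(H)$ the maximum cardinality of a minimal total dominating set; $H$ is well $\gamma_t$-dominated if $\gamma_t(H)=\Gamma_t(H)$. -}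

module Defs where

open import Data.Nat using (ℕ; _≤_)
open import Data.Bool using (Bool; true; false)
open import Data.Fin using (Fin; _≟_)
open import Data.List using (List; length; filterᵇ; allFin; concatMap; map)
open import Data.Product using (Σ; ∃; _×_; _,_)
open import Relation.Nullary using (¬_; yes; no)
open import Relation.Binary.PropositionalEquality using (_≡_; refl; sym)

-- Cardinalities are counted w.r.t. an explicit duplicate-free
-- enumeration of V (allFin n for Fin n, see lexVerts for G[Φ]).

record Graph (V : Set) : Set where
  field
    adj        : V → V → Bool
    adj-sym    : ∀ u v → adj u v ≡ adj v u
    adj-irrefl : ∀ v → adj v v ≡ false
open Graph public

VSet : Set → Set
VSet V = V → Bool

card : {V : Set} → List V → VSet V → ℕ
card vs S = length (filterᵇ S vs)

_⊂_ : {V : Set} → VSet V → VSet V → Set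
_⊂_ {V} S T = (∀ v → S v ≡ true → T v ≡ true) × (∃ λ (v : V) → T v ≡ true × S v ≡ false)

IsTDS : {V : Set} → Graph V → VSet V → Set
IsTDS {V} G S = ∀ (v : V) → ∃ λ (u : V) → S u ≡ true × adj G v u ≡ true

IsMinimalTDS : {V : Set} → Graph V → VSet V → Set
IsMinimalTDS G S = IsTDS G S × (∀ T → T ⊂ S → ¬ IsTDS G T)

IsγTotal : {V : Set} → Graph V → List V → ℕ → Set
IsγTotal G vs k =
  (∃ λ S → IsMinimalTDS G S × card vs S ≡ k) ×
  (∀ S → IsMinimalTDS G S → k ≤ card vs S)

IsΓTotal : {V : Set} → Graph V → List V → ℕ → Set
IsΓTotal G vs k =
  (∃ λ S → IsMinimalTDS G S × card vs S ≡ k) ×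
  (∀ S → IsMinimalTDS G S → card vs S ≤ k)

WellγtDominated : {V : Set} → Graph V → List V → Set
WellγtDominated G vs = ∃ λ k → IsγTotal G vs k × IsΓTotal G vs k

degree : {m : ℕ} → Graph (Fin m) → Fin m → ℕ
degree {m} G v = length (filterᵇ (adj G v) (allFin m))

IsMinDegree : {m : ℕ} → Graph (Fin m) → ℕ → Set
IsMinDegree {m} G d = (∃ λ (v : Fin m) → degree G v ≡ d) × (∀ v → d ≤ degree G v)

data Reach {V : Set} (G : Graph V) : V → V → Set where
  here : ∀ {v} → Reach G v v
  step : ∀ {u w v} → adj G u w ≡ true → Reach G w v → Reach G u v

Connected : {V : Set} → Graph V → Set
Connected G = ∀ u v → Reach G u v

module _ {n : ℕ} (G : Graph (Fin n)) {ms : Fin n → ℕ}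
         (F : (i : Fin n) → Graph (Fin (ms i))) where

  LexV : Set
  LexV = Σ (Fin n) (λ i → Fin (ms i))

  lexAdj : (i j : Fin n) → Fin (ms i) → Fin (ms j) → Bool
  lexAdj i j x y with i ≟ j
  ... | yes refl = adj (F i) x y
  ... | no _     = adj G i j

  lexAdj-sym : ∀ i j x y → lexAdj i j x y ≡ lexAdj j i y x
  lexAdj-sym i j x y with i ≟ j | j ≟ i
  ... | yes refl | yes refl = adj-sym (F i) x y
  ... | yes refl | no ¬p    with ¬p refl
  ... | ()
  lexAdj-sym i j x y | no ¬p | yes refl with ¬p refl
  ... | ()
  lexAdj-sym i j x y | no _ | no _ = adj-sym G i j

  lexAdj-irrefl : ∀ i x → lexAdj i i x x ≡ false
  lexAdj-irrefl i x with i ≟ i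
  ... | yes refl = adj-irrefl (F i) x
  ... | no ¬p with ¬p refl
  ... | ()

  Lex : Graph LexV
  Lex = record
    { adj        = λ { (i , x) (j , y) → lexAdj i j x y }
    ; adj-sym    = λ { (i , x) (j , y) → lexAdj-sym i j x y }
    ; adj-irrefl = λ { (i , x) → lexAdj-irrefl i x }
    }

  lexVerts : List LexV
  lexVerts = concatMap (λ i → map (λ x → (i , x)) (allFin (ms i))) (allFin n)

module Submission where

-- A minimal total dominating set S of G[Φ] meets every fibre V(F_i) at most once.
-- Indeed, each F_i has an isolated vertex, which can only be dominated from another
-- fibre; hence the projection of S to G is a total dominating set of G, and S stays
-- total dominating as long as it meets the same fibres, so a second vertex of S in a
-- fibre could be dropped. Thus projection maps minimal TDSs of G[Φ] to minimal TDSs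
-- of G of the same size; conversely, placing one vertex in each fibre over a minimal
-- TDS of G gives a minimal TDS of G[Φ] of the same size. So G and G[Φ] have the same
-- sizes of minimal TDSs.

open import Defs
open import Data.Bool using (Bool; true; false; _∧_; T)
open import Data.Bool.Properties using (T-≡; ⇔→≡)
open import Data.Fin using (Fin; _≟_) renaming (zero to fzero; suc to fsuc)
open import Data.Fin.Properties using (suc-injective)
open import Data.Bool.ListAction using (any)
open import Data.List using (List; []; _∷_; _++_; tabulate; allFin; filterᵇ; length; map; concatMap)
open import Data.Nat.ListAction using (sum)
open import Data.List.Membership.Propositional using (_∈_)
open import Data.List.Membership.Propositional.Properties using (∈-allFin)
open import Data.List.Properties using (map-cong; length-++; filter-++; filter-≐)
open import Data.List.Relation.Unary.Any using (here; there)
open import Data.List.Relation.Unary.Any.Properties using (any⁺; any⁻; tabulate⁺; tabulate⁻)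
open import Data.Nat using (ℕ; suc; _+_; _≤_)
open import Data.Product using (∃; _×_; _,_; proj₁; proj₂; map₂)
open import Data.Product.Properties using (≡-dec)
open import Function using (_∘_)
open import Function.Bundles using (_⇔_; mk⇔; Equivalence)
open import Relation.Binary.Definitions using (DecidableEquality)
open import Relation.Binary.PropositionalEquality
  using (_≡_; _≢_; refl; sym; trans; cong; subst; module ≡-Reasoning)
open import Relation.Nullary using (yes; no; contradiction)
open import Relation.Nullary.Decidable using (T?)

open Equivalence using (to; from)

indicator : Bool → ℕ
indicator true  = 1
indicator false = 0

module _ {A : Set} (p : A → Bool) where

  length-filterᵇ-++ : ∀ xs ys →
    length (filterᵇ p (xs ++ ys)) ≡ length (filterᵇ p xs) + length (filterᵇ p ys)
  length-filterᵇ-++ xs ys =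
    trans (cong length (filter-++ (T? ∘ p) xs ys)) (length-++ (filterᵇ p xs))

  length-filterᵇ-concatMap : ∀ {B : Set} (f : B → List A) bs →
    length (filterᵇ p (concatMap f bs)) ≡ sum (map (λ b → length (filterᵇ p (f b))) bs)
  length-filterᵇ-concatMap f []       = refl
  length-filterᵇ-concatMap f (b ∷ bs) =
    trans (length-filterᵇ-++ (f b) (concatMap f bs))
          (cong (length (filterᵇ p (f b)) +_) (length-filterᵇ-concatMap f bs))

  length-filterᵇ-map : ∀ {B : Set} (g : B → A) bs →
    length (filterᵇ p (map g bs)) ≡ length (filterᵇ (p ∘ g) bs)
  length-filterᵇ-map g []       = refl
  length-filterᵇ-map g (b ∷ bs) with p (g b)
  ... | true  = cong suc (length-filterᵇ-map g bs)
  ... | false = length-filterᵇ-map g bs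

  length-filterᵇ≡sum-indicator : ∀ xs → length (filterᵇ p xs) ≡ sum (map (indicator ∘ p) xs)
  length-filterᵇ≡sum-indicator []       = refl
  length-filterᵇ≡sum-indicator (x ∷ xs) with p x
  ... | true  = cong suc (length-filterᵇ≡sum-indicator xs)
  ... | false = length-filterᵇ≡sum-indicator xs

  length-filterᵇ≡0⇒false : ∀ xs → length (filterᵇ p xs) ≡ 0 → ∀ {x} → x ∈ xs → p x ≡ false
  length-filterᵇ≡0⇒false (y ∷ xs) empty x∈ with p y in py | x∈
  ... | false | here refl  = py
  ... | false | there x∈xs = length-filterᵇ≡0⇒false xs empty x∈xs

  any-tabulate⁺ : ∀ {m} {f : Fin m → A} i → p (f i) ≡ true → any p (tabulate f) ≡ true
  any-tabulate⁺ i pfi = to T-≡ (any⁺ p (tabulate⁺ i (from T-≡ pfi)))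

  any-tabulate⁻ : ∀ {m} (f : Fin m → A) → any p (tabulate f) ≡ true → ∃ λ i → p (f i) ≡ true
  any-tabulate⁻ f anyp =
    map₂ (to T-≡) (tabulate⁻ (any⁻ p (tabulate f) (from T-≡ anyp)))

  length-filterᵇ-tabulate-unique : ∀ {m} (f : Fin m → A) →
    (∀ i j → p (f i) ≡ true → p (f j) ≡ true → i ≡ j) →
    length (filterᵇ p (tabulate f)) ≡ indicator (any p (tabulate f))
  length-filterᵇ-tabulate-unique {0}     f unique = refl
  length-filterᵇ-tabulate-unique {suc m} f unique
    with p (f fzero) in p₀
       | length-filterᵇ-tabulate-unique (f ∘ fsuc) (λ i j pi pj → suc-injective (unique _ _ pi pj))
  ... | false | ih = ih
  ... | true  | ih = cong suc (trans ih (cong indicator rest))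
    where
    rest : any p (tabulate (f ∘ fsuc)) ≡ false
    rest with any p (tabulate (f ∘ fsuc)) in anyp
    ... | false = refl
    ... | true  with any-tabulate⁻ (f ∘ fsuc) anyp
    ...   | i , pi with unique fzero (fsuc i) p₀ pi
    ...     | ()

card-cong : ∀ {V : Set} (vs : List V) {S₁ S₂ : VSet V} → (∀ v → S₁ v ≡ S₂ v) →
            card vs S₁ ≡ card vs S₂
card-cong vs {S₁} {S₂} S₁≗S₂ = cong length (filter-≐ (T? ∘ S₁) (T? ∘ S₂) (S₁⊆S₂ , S₂⊆S₁) vs)
  where
  S₁⊆S₂ : ∀ {v} → T (S₁ v) → T (S₂ v)
  S₁⊆S₂ {v} = subst T (S₁≗S₂ v)
  S₂⊆S₁ : ∀ {v} → T (S₂ v) → T (S₁ v)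
  S₂⊆S₁ {v} = subst T (sym (S₁≗S₂ v))

remove : {V : Set} → DecidableEquality V → VSet V → V → VSet V
remove _≟_ S v w with w ≟ v
... | yes _ = false
... | no _  = S w

module _ {V : Set} (_≟_ : DecidableEquality V) (S : VSet V) (v : V) where

  remove-⊂ : S v ≡ true → remove _≟_ S v ⊂ S
  remove-⊂ Sv = removed⊆S , v , Sv , v-removed
    where
    removed⊆S : ∀ w → remove _≟_ S v w ≡ true → S w ≡ true
    removed⊆S w Sw with w ≟ v
    ... | yes _ = contradiction Sw λ ()
    ... | no _  = Sw
    v-removed : remove _≟_ S v v ≡ false
    v-removed with v ≟ v
    ... | yes _  = refl
    ... | no v≢v = contradiction refl v≢v

  remove-≢ : ∀ {w} → w ≢ v → remove _≟_ S v w ≡ S w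
  remove-≢ {w} w≢v with w ≟ v
  ... | yes w≡v = contradiction w≡v w≢v
  ... | no _    = refl

Isolated : {V : Set} → Graph V → V → Set
Isolated H x = ∀ y → adj H x y ≡ false

minDegree0⇒isolated : ∀ {m} (H : Graph (Fin m)) → IsMinDegree H 0 → ∃ (Isolated H)
minDegree0⇒isolated {m} H ((x , deg≡0) , _) =
  x , λ y → length-filterᵇ≡0⇒false (adj H x) (allFin m) deg≡0 (∈-allFin y)

MinimalTDSCardsEmbed : {V W : Set} → Graph V → List V → Graph W → List W → Set
MinimalTDSCardsEmbed G vs H ws =
  ∀ S → IsMinimalTDS G S → ∃ λ T → IsMinimalTDS H T × card ws T ≡ card vs S

module _ {V W : Set} (G : Graph V) (vs : List V) (H : Graph W) (ws : List W)
         (G↪H : MinimalTDSCardsEmbed G vs H ws) (H↪G : MinimalTDSCardsEmbed H ws G vs) where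

  isγTotal-transfer : ∀ {k} → IsγTotal G vs k → IsγTotal H ws k
  isγTotal-transfer ((S , minS , |S|≡k) , k≤) =
    (let (T , minT , |T|≡|S|) = G↪H S minS in T , minT , trans |T|≡|S| |S|≡k) ,
    λ T minT → let (S′ , minS′ , |S′|≡|T|) = H↪G T minT in subst (_ ≤_) |S′|≡|T| (k≤ S′ minS′)

  isΓTotal-transfer : ∀ {k} → IsΓTotal G vs k → IsΓTotal H ws k
  isΓTotal-transfer ((S , minS , |S|≡k) , ≤k) =
    (let (T , minT , |T|≡|S|) = G↪H S minS in T , minT , trans |T|≡|S| |S|≡k) ,
    λ T minT → let (S′ , minS′ , |S′|≡|T|) = H↪G T minT in subst (_≤ _) |S′|≡|T| (≤k S′ minS′)

  wellγtDominated-transfer : WellγtDominated G vs → WellγtDominated H ws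
  wellγtDominated-transfer (k , γ , Γ) = k , isγTotal-transfer γ , isΓTotal-transfer Γ

module _ {n : ℕ} (G : Graph (Fin n)) {ms : Fin n → ℕ} (F : (i : Fin n) → Graph (Fin (ms i))) where

  adj-Lex-≡ : ∀ i x y → adj (Lex G F) (i , x) (i , y) ≡ adj (F i) x y
  adj-Lex-≡ i x y with i ≟ i
  ... | yes refl = refl
  ... | no i≢i   = contradiction refl i≢i

  adj-Lex-≢ : ∀ {i j} x y → i ≢ j → adj (Lex G F) (i , x) (j , y) ≡ adj G i j
  adj-Lex-≢ {i} {j} x y i≢j with i ≟ j
  ... | yes i≡j = contradiction i≡j i≢j
  ... | no _    = refl

  project : VSet (LexV G F) → VSet (Fin n)
  project S i = any (λ x → S (i , x)) (allFin (ms i))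

  MeetsFibresOver : VSet (Fin n) → VSet (LexV G F) → Set
  MeetsFibresOver T S = ∀ j → T j ≡ true → ∃ λ y → S (j , y) ≡ true

  AtMostOnePerFibre : VSet (LexV G F) → Set
  AtMostOnePerFibre S = ∀ i x y → S (i , x) ≡ true → S (i , y) ≡ true → x ≡ y

  meetsFibresOver-project : ∀ S → MeetsFibresOver (project S) S
  meetsFibresOver-project S j = any-tabulate⁻ (λ y → S (j , y)) (λ y → y)

  project-intro : ∀ S {i} x → S (i , x) ≡ true → project S i ≡ true
  project-intro S {i} = any-tabulate⁺ (λ y → S (i , y))

  isTDS-meetsFibresOver : ∀ {T S} → IsTDS G T → MeetsFibresOver T S → IsTDS (Lex G F) S
  isTDS-meetsFibresOver {T} tds meets (i , x) with tds i
  ... | j , Tj , adjij with meets j Tj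
  ...   | y , Sy = (j , y) , Sy , trans (adj-Lex-≢ x y i≢j) adjij
    where
    i≢j : i ≢ j
    i≢j refl = contradiction (trans (sym adjij) (adj-irrefl G i)) λ ()

  restrict : VSet (Fin n) → VSet (LexV G F) → VSet (LexV G F)
  restrict T S (i , x) = T i ∧ S (i , x)

  liftAt : ((i : Fin n) → Fin (ms i)) → VSet (Fin n) → VSet (LexV G F)
  liftAt base T (i , x) with x ≟ base i
  ... | yes _ = T i
  ... | no _  = false

  card-atMostOnePerFibre : ∀ {S} → AtMostOnePerFibre S →
                           card (lexVerts G F) S ≡ card (allFin n) (project S)
  card-atMostOnePerFibre {S} unique = begin
    card (lexVerts G F) S
      ≡⟨ length-filterᵇ-concatMap S _ (allFin n) ⟩
    sum (map (λ i → length (filterᵇ S (map (i ,_) (allFin (ms i))))) (allFin n))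
      ≡⟨ cong sum (map-cong fibreCard (allFin n)) ⟩
    sum (map (indicator ∘ project S) (allFin n))
      ≡⟨ length-filterᵇ≡sum-indicator (project S) (allFin n) ⟨
    card (allFin n) (project S) ∎
    where
    open ≡-Reasoning
    fibreCard : ∀ i → length (filterᵇ S (map (i ,_) (allFin (ms i)))) ≡ indicator (project S i)
    fibreCard i = trans (length-filterᵇ-map S (i ,_) (allFin (ms i)))
                        (length-filterᵇ-tabulate-unique _ _ (unique i))

  module _ (base : (i : Fin n) → Fin (ms i)) where

    liftAt-base : ∀ T i → liftAt base T (i , base i) ≡ T i
    liftAt-base T i with base i ≟ base i
    ... | yes _  = refl
    ... | no b≢b = contradiction refl b≢b

    liftAt-true : ∀ T i x → liftAt base T (i , x) ≡ true → x ≡ base i × T i ≡ true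
    liftAt-true T i x lifted with x ≟ base i
    ... | yes x≡b = x≡b , lifted
    ... | no _    = contradiction lifted λ ()

    atMostOnePerFibre-liftAt : ∀ T → AtMostOnePerFibre (liftAt base T)
    atMostOnePerFibre-liftAt T i x y Lx Ly =
      trans (proj₁ (liftAt-true T i x Lx)) (sym (proj₁ (liftAt-true T i y Ly)))

    project-liftAt : ∀ T i → project (liftAt base T) i ≡ T i
    project-liftAt T i = ⇔→≡ (mk⇔
      (λ met → let (x , lifted) = meetsFibresOver-project (liftAt base T) i met
               in proj₂ (liftAt-true T i x lifted))
      (λ Ti → project-intro (liftAt base T) (base i) (trans (liftAt-base T i) Ti)))

  module _ (isolated : ∀ i → ∃ (Isolated (F i))) where

    project-isTDS : ∀ {S} → IsTDS (Lex G F) S → IsTDS G (project S)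
    project-isTDS {S} tds i with isolated i
    ... | x , x-isolated with tds (i , x)
    ...   | (j , y) , Sy , adjxy = j , project-intro S y Sy , trans (sym (adj-Lex-≢ x y i≢j)) adjxy
      where
      i≢j : i ≢ j
      i≢j refl = contradiction (trans (sym adjxy) (trans (adj-Lex-≡ i x y) (x-isolated y))) λ ()

    isTDS-sameFibres : ∀ {S S′} → IsTDS (Lex G F) S → MeetsFibresOver (project S) S′ →
                       IsTDS (Lex G F) S′
    isTDS-sameFibres tds = isTDS-meetsFibresOver (project-isTDS tds)

    minimalTDS-atMostOnePerFibre : ∀ {S} → IsMinimalTDS (Lex G F) S → AtMostOnePerFibre S
    minimalTDS-atMostOnePerFibre {S} (tds , minimal) i x y Sx Sy with x ≟ y
    ... | yes x≡y = x≡y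
    ... | no x≢y  =
      contradiction (isTDS-sameFibres tds meets) (minimal S′ (remove-⊂ _≟ᴸ_ S (i , y) Sy))
      where
      _≟ᴸ_ : DecidableEquality (LexV G F)
      _≟ᴸ_ = ≡-dec _≟_ _≟_
      S′ : VSet (LexV G F)
      S′ = remove _≟ᴸ_ S (i , y)
      meets : MeetsFibresOver (project S) S′
      meets j Sj with meetsFibresOver-project S j Sj
      ... | w , Sw with (j , w) ≟ᴸ (i , y)
      ...   | yes refl  = x , trans (remove-≢ _≟ᴸ_ S (i , y) λ { refl → x≢y refl }) Sx
      ...   | no jw≢iy = w , trans (remove-≢ _≟ᴸ_ S (i , y) jw≢iy) Sw

    project-isMinimalTDS : ∀ {S} → IsMinimalTDS (Lex G F) S → IsMinimalTDS G (project S)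
    project-isMinimalTDS {S} (tds , minimal) = project-isTDS tds , λ T T⊂ tdsT →
      minimal (restrict T S) (restrict-⊂ T⊂) (isTDS-meetsFibresOver tdsT (meets (proj₁ T⊂)))
      where
      restrict-⊂ : ∀ {T} → T ⊂ project S → restrict T S ⊂ S
      restrict-⊂ {T} (_ , j , Sj , Tj≡false) with meetsFibresOver-project S j Sj
      ... | y , Sy = restrict⊆S , (j , y) , Sy , cong (_∧ S (j , y)) Tj≡false
        where
        restrict⊆S : ∀ v → restrict T S v ≡ true → S v ≡ true
        restrict⊆S (i , x) kept with T i
        ... | true = kept
      meets : ∀ {T} → (∀ j → T j ≡ true → project S j ≡ true) → MeetsFibresOver T (restrict T S)
      meets T⊆ j Tj with meetsFibresOver-project S j (T⊆ j Tj)
      ... | y , Sy = y , trans (cong (_∧ S (j , y)) Tj) Sy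

    base : (i : Fin n) → Fin (ms i)
    base i = proj₁ (isolated i)

    liftAt-isMinimalTDS : ∀ {T} → IsMinimalTDS G T → IsMinimalTDS (Lex G F) (liftAt base T)
    liftAt-isMinimalTDS {T} (tds , minimal) =
      isTDS-meetsFibresOver tds (λ j Tj → base j , trans (liftAt-base base T j) Tj) ,
      λ { S′ (S′⊆ , (j , y) , lifted , S′jy≡false) tdsS′ →
          minimal (project S′) (projected⊆T S′⊆ , j , proj₂ (liftAt-true base T j y lifted) ,
                                unmet S′⊆ lifted S′jy≡false)
                  (project-isTDS tdsS′) }
      where
      projected⊆T : ∀ {S′} → (∀ v → S′ v ≡ true → liftAt base T v ≡ true) →
                    ∀ k → project S′ k ≡ true → T k ≡ true
      projected⊆T {S′} S′⊆ k met with meetsFibresOver-project S′ k met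
      ... | w , S′w = proj₂ (liftAt-true base T k w (S′⊆ _ S′w))
      unmet : ∀ {S′ j y} → (∀ v → S′ v ≡ true → liftAt base T v ≡ true) →
              liftAt base T (j , y) ≡ true → S′ (j , y) ≡ false → project S′ j ≡ false
      unmet {S′} {j} {y} S′⊆ lifted S′jy≡false with project S′ j in met
      ... | false = refl
      ... | true with meetsFibresOver-project S′ j met
      ...   | w , S′w with atMostOnePerFibre-liftAt base T j w y (S′⊆ _ S′w) lifted
      ...     | refl = contradiction (trans (sym S′w) S′jy≡false) λ ()

    minimalTDS-Lex↪G : MinimalTDSCardsEmbed (Lex G F) (lexVerts G F) G (allFin n)
    minimalTDS-Lex↪G S minS =
      project S , project-isMinimalTDS minS ,
      sym (card-atMostOnePerFibre (minimalTDS-atMostOnePerFibre minS))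

    minimalTDS-G↪Lex : MinimalTDSCardsEmbed G (allFin n) (Lex G F) (lexVerts G F)
    minimalTDS-G↪Lex T minT =
      liftAt base T , liftAt-isMinimalTDS minT ,
      trans (card-atMostOnePerFibre (atMostOnePerFibre-liftAt base T))
            (card-cong (allFin n) (project-liftAt base T))

    wellγtDominated-Lex⇔ : WellγtDominated (Lex G F) (lexVerts G F) ⇔ WellγtDominated G (allFin n)
    wellγtDominated-Lex⇔ =
      mk⇔ (wellγtDominated-transfer (Lex G F) (lexVerts G F) G (allFin n)
             minimalTDS-Lex↪G minimalTDS-G↪Lex)
          (wellγtDominated-transfer G (allFin n) (Lex G F) (lexVerts G F)
             minimalTDS-G↪Lex minimalTDS-Lex↪G)

theorem3p11 : (n : ℕ) → 2 ≤ n → (G : Graph (Fin n)) → Connected G →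
    (ms : Fin n → ℕ) → (F : (i : Fin n) → Graph (Fin (ms i))) →
    (∀ i → IsMinDegree (F i) 0) → (∀ i → 2 ≤ ms i) →
    WellγtDominated (Lex G F) (lexVerts G F) ⇔ WellγtDominated G (allFin n)
theorem3p11 n _ G _ ms F minDegree0 _ =
  wellγtDominated-Lex⇔ G F (λ i → minDegree0⇒isolated (F i) (minDegree0 i))
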